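{- Let $J=(X,k,\mathcal{R}=(R_1,\ldots,R_m))$ be an instance of Binary Constrained Clustering and $\delta\ge0$. Let $B\subseteq X$ and $C_1\subseteq\{0,1\}^m$ be a set of $k'\le k$ vectors such that $(C_1,B)$ is $\delta$-extendable for $J$. Then there is a good $\delta$-extension $C_2$ of $(C_1,B)$.
   Context: A $k$-tuple $(\mathbf{c}_1,\ldots,\mathbf{c}_k)$ of vectors in $\{0,1\}^m$ satisfies $\mathcal{R}=(R_1,\ldots,R_m)$, $R_i\subseteq\{0,1\}^k$, if $(\mathbf{c}_1[i],\ldots,\mathbf{c}_k[i])\in R_i$ for all $i$; a set of vectors satisfies a family of relations if some ordering of it does. For an instance $J=(X,k,\mathcal{R})$ of Binary Constrained Clustering, $\mathrm{cost}(A,Y)=\sum_{\mathbf{x}\in A}\min_{\mathbf{y}\in Y}d_H(\mathbf{x},\mathbf{y})$ ($d_H$ = Hamming distance) and $\mathrm{OPT}(J)$ is the minimum of $\mathrm{cost}(X,C)$ over $C$ satisfying $\mathcal{R}$; a solution is optimal if it attains this. Projection: for $I=\{i_1<\cdots<i_s\}\subseteq\{1,\ldots,k\}$, $\mathrm{proj}_I(\mathcal{R})=(\{(t[i_1],\ldots,t[i_s]):t\in R_j\})_{j=1}^m$. Reduction: for an ordered tuple $C_1=(\mathbf{c}_1,\ldots,\mathbf{c}_s)$ of vectors in $\{0,1\}^m$, $\mathcal{R}(I,C_1)=(R'_1,\ldots,R'_m)$ where $R'_j$ is the set of $(k-s)$-tuples $(t[i])_{i\in\{1,\ldots,k\}\setminus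 I}$ (increasing order) over all $t\in R_j$ with $t[i_q]=\mathbf{c}_q[j]$ for all $q\in\{1,\ldots,s\}$. For $B\subseteq X$ and a set $C_1$ of $k_1\le k$ vectors, $(C_1,B)$ is $\delta$-extendable for $J$ if there is a set $C_2$ of $k-k_1$ vectors such that $C_1\cup C_2$ satisfies $\mathcal{R}$ and $\mathrm{cost}(B,C_1)+\mathrm{cost}(X\setminus B,C_1\cup C_2)\le(1+\delta)\mathrm{OPT}(J)$; $C_2$ is then a $\delta$-extension of $(C_1,B)$. A $\delta$-extension $C_2$ of $(C_1,B)$ is good if there are a partition $Z_1\uplus Z_2=X\setminus B$ and $I\subseteq\{1,\ldots,k\}$ with $|I|=|C_1|$ such that $\mathrm{cost}(X\setminus B,C_1\cup C_2)=\mathrm{cost}(Z_1,C_1)+\mathrm{cost}(Z_2,C_2)$, $C_1$ (in some ordering) satisfies $\mathrm{proj}_I(\mathcal{R})$, and $C_2$ is an optimal solution of the instance $(Z_2,k-|C_1|,\mathcal{R}(I,C_1))$ (with $C_1$ taken in that ordering). -}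

module Defs where

open import Data.Bool using (Bool; true; false; not; _xor_; T)
open import Data.Nat as ℕ using (ℕ; zero; suc; _∸_)
open import Data.Nat.Properties using (m+[n∸m]≡n)
open import Data.Fin using (Fin)
open import Data.Vec as Vec using (Vec; []; _∷_; lookup; tabulate; toList; _++_; cast)
open import Data.List using (List; []; _∷_)
open import Data.Product using (Σ; ∃; ∃-syntax; _×_; _,_)
open import Data.Unit using (⊤)
open import Data.Empty using (⊥)
open import Data.Integer using (+_)
open import Data.Rational as ℚ using (ℚ; 1ℚ; _/_)
open import Data.Fin.Permutation using (Permutation′; _⟨$⟩ʳ_)
open import Relation.Binary.PropositionalEquality using (_≡_)

BVec : ℕ → Set
BVec m = Vec Bool m

dH : ∀ {m} → BVec m → BVec m → ℕ
dH []       []       = 0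
dH (a ∷ u) (b ∷ v) with a xor b
... | true  = suc (dH u v)
... | false = dH u v

-- Extended naturals (costs may be ∞ when there are no centres)

data ℕ∞ : Set where
  fin : ℕ → ℕ∞
  ∞   : ℕ∞

_⊕_ : ℕ∞ → ℕ∞ → ℕ∞
fin a ⊕ fin b = fin (a ℕ.+ b)
_     ⊕ _     = ∞

min∞ : ℕ∞ → ℕ∞ → ℕ∞
min∞ (fin a) (fin b) = fin (a ℕ.⊓ b)
min∞ (fin a) ∞       = fin a
min∞ ∞       b       = b

_≤∞_ : ℕ∞ → ℕ∞ → Set
fin a ≤∞ fin b = a ℕ.≤ b
fin a ≤∞ ∞     = ⊤
∞     ≤∞ fin b = ⊥
∞     ≤∞ ∞     = ⊤

LeScaled : ℕ∞ → ℚ → ℕ∞ → Set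
LeScaled a       δ ∞       = ⊤
LeScaled ∞       δ (fin o) = ⊥
LeScaled (fin a) δ (fin o) = (+ a / 1) ℚ.≤ ((1ℚ ℚ.+ δ) ℚ.* (+ o / 1))

-- Costs.  A point set is X : Vec (BVec m) n; a sub(multi)set A of X is
-- given by membership flags  A : Vec Bool n  (point i belongs iff A[i]).
-- Centres are tuples  Vec (BVec m) c.

minDist : ∀ {m c} → BVec m → Vec (BVec m) c → ℕ∞
minDist x []       = ∞
minDist x (y ∷ ys) = min∞ (fin (dH x y)) (minDist x ys)

cost : ∀ {m n c} → Vec (BVec m) n → Vec Bool n → Vec (BVec m) c → ℕ∞
cost []       []           Y = fin 0
cost (x ∷ xs) (true  ∷ fs) Y = minDist x Y ⊕ cost xs fs Y
cost (x ∷ xs) (false ∷ fs) Y = cost xs fs Y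

compl : ∀ {n} → Vec Bool n → Vec Bool n
compl = Vec.map not

_∧f_ : ∀ {n} → Vec Bool n → Vec Bool n → Vec Bool n
_∧f_ = Vec.zipWith Data.Bool._∧_

-- Relations.  R = (R_1,…,R_m), R_j ⊆ {0,1}^k, given by characteristic
-- functions.  A generic family of relations on s-tuples is
-- Fin m → List Bool → Set (membership of a tuple as a list).

Rels : ℕ → ℕ → Set
Rels m k = Fin m → BVec k → Bool

col : ∀ {m s} → Fin m → Vec (BVec m) s → BVec s
col j C = Vec.map (λ c → lookup c j) C

SatT : ∀ {m k} → Rels m k → Vec (BVec m) k → Set
SatT R C = ∀ j → T (R j (col j C))

reorder : ∀ {A : Set} {s} → Permutation′ s → Vec A s → Vec A s
reorder σ C = tabulate (λ i → lookup C (σ ⟨$⟩ʳ i))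

Sat : ∀ {m k} → Rels m k → Vec (BVec m) k → Set
Sat R C = ∃[ σ ] SatT R (reorder σ C)

PRels : ℕ → ℕ → Set₁
PRels m s = Fin m → BVec s → Set

SatTP : ∀ {m s} → PRels m s → Vec (BVec m) s → Set
SatTP R C = ∀ j → R j (col j C)

SatP : ∀ {m s} → PRels m s → Vec (BVec m) s → Set
SatP R C = ∃[ σ ] SatTP R (reorder σ C)

-- subsets I ⊆ {1,…,k} as flag vectors; sel I t = (t[i])_{i ∈ I} in increasing order
sel : ∀ {A : Set} {k} → Vec Bool k → Vec A k → List A
sel []           []       = []
sel (true  ∷ I) (a ∷ t)  = a ∷ sel I t
sel (false ∷ I) (a ∷ t)  = sel I t

count : ∀ {k} → Vec Bool k → ℕ
count []          = 0
count (true ∷ I)  = suc (count I)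
count (false ∷ I) = count I

SatProj : ∀ {m k s} → Rels m k → Vec Bool k → Vec (BVec m) s → Set
SatProj R I C = ∀ j → ∃[ t ] (T (R j t) × sel I t ≡ toList (col j C))

reduce : ∀ {m k s r} → Rels m k → Vec Bool k → Vec (BVec m) s → PRels m r
reduce R I C1 j u =
  ∃[ t ] (T (R j t) × sel I t ≡ toList (col j C1) × sel (compl I) t ≡ toList u)

IsOPT : ∀ {m n k} → Vec (BVec m) n → Vec Bool n → Rels m k → ℕ∞ → Set
IsOPT X A R o =
  (∃[ C ] (Sat R C × cost X A C ≡ o)) × (∀ C → Sat R C → o ≤∞ cost X A C)

allFlags : ∀ n → Vec Bool n
allFlags n = Vec.replicate n true

union : ∀ {m k k'} → k' ℕ.≤ k → Vec (BVec m) k' → Vec (BVec m) (k ∸ k') → Vec (BVec m) k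
union h C1 C2 = cast (m+[n∸m]≡n h) (C1 ++ C2)

IsExtension : ∀ {m n k k'} (X : Vec (BVec m) n) (R : Rels m k) (δ : ℚ)
  (h : k' ℕ.≤ k) (C1 : Vec (BVec m) k') (B : Vec Bool n) (C2 : Vec (BVec m) (k ∸ k')) → Set
IsExtension {n = n} X R δ h C1 B C2 =
  Sat R (union h C1 C2) ×
  (∀ o → IsOPT X (allFlags n) R o →
     LeScaled (cost X B C1 ⊕ cost X (compl B) (union h C1 C2)) δ o)

Extendable : ∀ {m n k k'} (X : Vec (BVec m) n) (R : Rels m k) (δ : ℚ)
  (h : k' ℕ.≤ k) (C1 : Vec (BVec m) k') (B : Vec Bool n) → Set
Extendable X R δ h C1 B = ∃[ C2 ] IsExtension X R δ h C1 B C2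

IsOptimalP : ∀ {m n r} → Vec (BVec m) n → Vec Bool n → PRels m r → Vec (BVec m) r → Set
IsOptimalP X Z R' C = SatP R' C × (∀ C' → SatP R' C' → cost X Z C ≤∞ cost X Z C')

-- good δ-extension. Z2 flags: point i ∈ Z2 iff i ∉ B and Z[i]; Z1 = (X∖B)∖Z2.
IsGood : ∀ {m n k k'} (X : Vec (BVec m) n) (R : Rels m k) (δ : ℚ)
  (h : k' ℕ.≤ k) (C1 : Vec (BVec m) k') (B : Vec Bool n) (C2 : Vec (BVec m) (k ∸ k')) → Set
IsGood {k = k} {k' = k'} X R δ h C1 B C2 =
  IsExtension X R δ h C1 B C2 ×
  ∃[ Z ] ∃[ I ]
    ( (cost X (compl B) (union h C1 C2)
         ≡ cost X (compl B ∧f compl Z) C1 ⊕ cost X (compl B ∧f Z) C2)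
    × count I ≡ k'
    × ∃[ σ ] ( SatProj R I (reorder σ C1)
             × IsOptimalP X (compl B ∧f Z) (reduce {r = k ∸ k'} R I (reorder σ C1)) C2))

-- Satisfying R by C₁ ∪ C₂ means that, for some positions I of size |C₁| and a
-- reordering of C₁, the remaining centres satisfy the reduced relations R(I, C₁);
-- this is decidable, and the candidate tuples form a finite searchable set. Take C₂
-- satisfying R(I, C₁) with least cost on X ∖ B, let Z be the points strictly closer
-- to C₂ than to C₁, and replace C₂ by an optimal solution C for Z under R(I, C₁).
-- Serving Z by C and the rest of X ∖ B by C₁ costs no more than C₂ does, while C₂
-- was already least, so cost(X ∖ B, C₁ ∪ C) splits exactly along Z and C is a good
-- extension that is no more expensive than the given one.

module Submission where

open import Defs
open import Data.Nat using (ℕ; _≤_)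
open import Data.Bool using (Bool)
open import Data.Vec using (Vec)
open import Data.Product using (∃-syntax; _×_)
open import Data.Rational using (ℚ; 0ℚ) renaming (_≤_ to _≤ℚ_)

open import Level using (0ℓ)
open import Function using (_∘_)
open import Data.Nat using (zero; suc; _+_; _∸_; _<_; _<?_)
import Data.Nat.Properties as ℕ
open import Data.Nat.Induction using (<-wellFounded)
open import Data.Bool using (true; false; T)
import Data.Bool.Properties as Bool
open import Data.Fin using (Fin; zero; suc; punchIn)
import Data.Fin.Properties as Fin
open import Data.Fin.Permutation as Perm using (Permutation′; _⟨$⟩ʳ_)
open import Data.Vec as Vec using ([]; _∷_; lookup; tabulate; toList; removeAt)
import Data.Vec.Properties as Vecₚ
open import Data.Vec.Membership.Propositional.Properties using (∈-toList⁻)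
import Data.Vec.Relation.Unary.Any as VecAny
open import Data.Vec.Relation.Unary.Any.Properties using (lookup-index)
open import Data.List as List using (List; []; _∷_; _++_)
import Data.List.Properties as List
open import Data.List.Membership.Propositional.Properties using (∈-++⁻; ∈-∃++)
open import Data.List.Relation.Unary.Any using (here)
open import Data.List.Relation.Binary.Permutation.Propositional
  using (_↭_; refl; prep; swap; trans; ↭-sym; ↭-reflexive)
open import Data.List.Relation.Binary.Permutation.Propositional.Properties
  using (↭-empty-inv; ↭-length; ∈-resp-↭; drop-∷; shift; ++⁺ˡ; ++⁺ʳ)
open import Data.Product using (∃; _,_)
open import Data.Sum using (inj₁; inj₂)
open import Data.Empty using (⊥; ⊥-elim)
open import Data.Unit using (⊤; tt)
open import Data.Integer using (+_)
import Data.Integer as ℤ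
import Data.Integer.Properties as ℤ
open import Data.Rational using (mkℚ; _/_)
import Data.Rational as ℚ
import Data.Rational.Properties as ℚ
import Data.Nat.Coprimality as Coprimality
open import Induction.WellFounded using (Acc; acc; WellFounded)
open import Relation.Nullary using (Dec; yes; no; ¬_; does)
open import Relation.Nullary.Decidable using (T?; _×-dec_; map′)
open import Relation.Unary using (Pred) renaming (Decidable to Decidable₁)
open import Relation.Binary.PropositionalEquality
  using (_≡_; refl; sym; cong; cong₂; subst; subst₂; module ≡-Reasoning)
import Relation.Binary.PropositionalEquality as Eq

private variable
  A B′ : Set

-- The order on ℕ∞

_<∞_ : ℕ∞ → ℕ∞ → Set
fin a <∞ fin b = a < b
fin _ <∞ ∞     = ⊤
∞     <∞ _     = ⊥

_<∞?_ : ∀ a b → Dec (a <∞ b)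
fin a <∞? fin b = a <? b
fin _ <∞? ∞     = yes tt
∞     <∞? _     = no λ ()

≤∞-∞ : ∀ a → a ≤∞ ∞
≤∞-∞ (fin _) = tt
≤∞-∞ ∞       = tt

≤∞-refl : ∀ {a} → a ≤∞ a
≤∞-refl {fin _} = ℕ.≤-refl
≤∞-refl {∞}     = tt

≤∞-reflexive : ∀ {a b} → a ≡ b → a ≤∞ b
≤∞-reflexive refl = ≤∞-refl

≤∞-trans : ∀ {a b c} → a ≤∞ b → b ≤∞ c → a ≤∞ c
≤∞-trans {fin _} {fin _} {fin _} p q = ℕ.≤-trans p q
≤∞-trans {a}     {_}     {∞}     _ _ = ≤∞-∞ a
≤∞-trans {fin _} {∞}     {fin _} _ ()
≤∞-trans {∞}     {fin _} {fin _} () _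
≤∞-trans {∞}     {∞}     {fin _} _ ()

≤∞-antisym : ∀ {a b} → a ≤∞ b → b ≤∞ a → a ≡ b
≤∞-antisym {fin _} {fin _} p q = cong fin (ℕ.≤-antisym p q)
≤∞-antisym {∞}     {∞}     _ _ = refl
≤∞-antisym {fin _} {∞}     _ ()
≤∞-antisym {∞}     {fin _} () _

≮∞⇒≥∞ : ∀ {a b} → ¬ (a <∞ b) → b ≤∞ a
≮∞⇒≥∞ {fin _} {fin _} a≮b = ℕ.≮⇒≥ a≮b
≮∞⇒≥∞ {fin _} {∞}     a≮b = ⊥-elim (a≮b tt)
≮∞⇒≥∞ {∞}     {b}     _   = ≤∞-∞ b

acc-fin : ∀ {n} → Acc _<_ n → Acc _<∞_ (fin n)
acc-fin (acc rs) = acc λ { {fin _} w<n → acc-fin (rs w<n) ; {∞} () }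

<∞-wellFounded : WellFounded _<∞_
<∞-wellFounded (fin n) = acc-fin (<-wellFounded n)
<∞-wellFounded ∞       = acc λ { {fin w} _ → acc-fin (<-wellFounded w) ; {∞} () }

⊕-mono-≤∞ : ∀ {a a′ b b′} → a ≤∞ a′ → b ≤∞ b′ → (a ⊕ b) ≤∞ (a′ ⊕ b′)
⊕-mono-≤∞ {fin _} {fin _}  {fin _} {fin _} p q = ℕ.+-mono-≤ p q
⊕-mono-≤∞ {a}     {∞}      {b}     {_}     _ _ = ≤∞-∞ (a ⊕ b)
⊕-mono-≤∞ {a}     {fin _}  {b}     {∞}     _ _ = ≤∞-∞ (a ⊕ b)
⊕-mono-≤∞ {∞}     {fin _}  {_}     {fin _} () _
⊕-mono-≤∞ {fin _} {fin _}  {∞}     {fin _} _ ()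

⊕-assoc : ∀ a b c → (a ⊕ b) ⊕ c ≡ a ⊕ (b ⊕ c)
⊕-assoc (fin a) (fin b) (fin c) = cong fin (ℕ.+-assoc a b c)
⊕-assoc (fin _) (fin _) ∞       = refl
⊕-assoc (fin _) ∞       _       = refl
⊕-assoc ∞       _       _       = refl

⊕-comm : ∀ a b → a ⊕ b ≡ b ⊕ a
⊕-comm (fin a) (fin b) = cong fin (ℕ.+-comm a b)
⊕-comm (fin _) ∞       = refl
⊕-comm ∞       (fin _) = refl
⊕-comm ∞       ∞       = refl

x⊕[y⊕z]≡y⊕[x⊕z] : ∀ a b c → a ⊕ (b ⊕ c) ≡ b ⊕ (a ⊕ c)
x⊕[y⊕z]≡y⊕[x⊕z] a b c = begin
  a ⊕ (b ⊕ c)  ≡⟨ sym (⊕-assoc a b c) ⟩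
  (a ⊕ b) ⊕ c  ≡⟨ cong (_⊕ c) (⊕-comm a b) ⟩
  (b ⊕ a) ⊕ c  ≡⟨ ⊕-assoc b a c ⟩
  b ⊕ (a ⊕ c)  ∎
  where open ≡-Reasoning

min∞-comm : ∀ a b → min∞ a b ≡ min∞ b a
min∞-comm (fin a) (fin b) = cong fin (ℕ.⊓-comm a b)
min∞-comm (fin _) ∞       = refl
min∞-comm ∞       (fin _) = refl
min∞-comm ∞       ∞       = refl

min∞-assoc : ∀ a b c → min∞ (min∞ a b) c ≡ min∞ a (min∞ b c)
min∞-assoc (fin a) (fin b) (fin c) = cong fin (ℕ.⊓-assoc a b c)
min∞-assoc (fin _) (fin _) ∞       = refl
min∞-assoc (fin _) ∞       (fin _) = refl
min∞-assoc (fin _) ∞       ∞       = refl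
min∞-assoc ∞       _       _       = refl

min∞-≤ˡ : ∀ a b → min∞ a b ≤∞ a
min∞-≤ˡ (fin a) (fin b) = ℕ.m⊓n≤m a b
min∞-≤ˡ (fin _) ∞       = ℕ.≤-refl
min∞-≤ˡ ∞       b       = ≤∞-∞ b

min∞-≤ʳ : ∀ a b → min∞ a b ≤∞ b
min∞-≤ʳ a b = subst (_≤∞ b) (min∞-comm b a) (min∞-≤ˡ b a)

min∞-selectʳ : ∀ a b → b <∞ a → min∞ a b ≡ b
min∞-selectʳ (fin _) (fin _) b<a = cong fin (ℕ.m≥n⇒m⊓n≡n (ℕ.<⇒≤ b<a))
min∞-selectʳ ∞       _       _   = refl

min∞-selectˡ : ∀ a b → ¬ (b <∞ a) → min∞ a b ≡ a
min∞-selectˡ (fin _) (fin _) b≮a = cong fin (ℕ.m≤n⇒m⊓n≡m (ℕ.≮⇒≥ b≮a))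
min∞-selectˡ (fin _) ∞       _   = refl
min∞-selectˡ ∞       (fin _) b≮a = ⊥-elim (b≮a tt)
min∞-selectˡ ∞       ∞       _   = refl

-- Minimisation over exhaustively searchable types

Searchable : Set → Set₁
Searchable A = (Q : Pred A 0ℓ) → Decidable₁ Q → Dec (∃ Q)

searchable-Bool : Searchable Bool
searchable-Bool Q Q? with Q? true | Q? false
... | yes q   | _       = yes (true , q)
... | no _    | yes q   = yes (false , q)
... | no ¬qt  | no ¬qf  = no λ { (true , q) → ¬qt q ; (false , q) → ¬qf q }

searchable-Vec : Searchable A → ∀ n → Searchable (Vec A n)
searchable-Vec _ zero Q Q? = map′ ([] ,_) (λ { ([] , q) → q }) (Q? [])
searchable-Vec search (suc n) Q Q? =
  map′ (λ (a , v , q) → a ∷ v , q) (λ { (a ∷ v , q) → a , v , q })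
       (search (λ a → ∃ λ v → Q (a ∷ v)) (λ a → searchable-Vec search n (Q ∘ (a ∷_)) (Q? ∘ (a ∷_))))

IsMinimumOf : (A → ℕ∞) → Pred A 0ℓ → A → Set
IsMinimumOf f Q a = Q a × (∀ b → Q b → f a ≤∞ f b)

module _ (search : Searchable A) {Q : Pred A 0ℓ} (Q? : Decidable₁ Q) (f : A → ℕ∞) where

  argmin-acc : ∀ a → Q a → Acc _<∞_ (f a) → ∃ (IsMinimumOf f Q)
  argmin-acc a qa (acc rs) with search (λ b → Q b × f b <∞ f a) (λ b → Q? b ×-dec (f b <∞? f a))
  ... | yes (b , qb , fb<fa) = argmin-acc b qb (rs fb<fa)
  ... | no ¬smaller = a , qa , λ b qb → ≮∞⇒≥∞ (λ fb<fa → ¬smaller (b , qb , fb<fa))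

  argmin : ∃ Q → ∃ (IsMinimumOf f Q)
  argmin (a , qa) = argmin-acc a qa (<∞-wellFounded (f a))

-- Reorderings of vectors versus permutations of lists

lookup-removeAt : ∀ {n} (xs : Vec A (suc n)) i j → lookup (removeAt xs i) j ≡ lookup xs (punchIn i j)
lookup-removeAt (_ ∷ _)      zero    _       = refl
lookup-removeAt (_ ∷ _ ∷ _)  (suc _) zero    = refl
lookup-removeAt (_ ∷ y ∷ xs) (suc i) (suc j) = lookup-removeAt (y ∷ xs) i j

toList-↭-lookup∷removeAt : ∀ {n} (xs : Vec A (suc n)) i → toList xs ↭ lookup xs i ∷ toList (removeAt xs i)
toList-↭-lookup∷removeAt (_ ∷ _)      zero    = refl
toList-↭-lookup∷removeAt (x ∷ y ∷ xs) (suc i) =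
  trans (prep x (toList-↭-lookup∷removeAt (y ∷ xs) i)) (swap x _ refl)

reorder-↭ : ∀ {n} (π : Permutation′ n) (xs : Vec A n) → toList (reorder π xs) ↭ toList xs
reorder-↭ {n = zero}  π []  = refl
reorder-↭ {n = suc n} π xs  = trans (prep _ tail↭) (↭-sym (toList-↭-lookup∷removeAt xs i))
  where
  i = π ⟨$⟩ʳ zero
  tail≡ : tabulate (λ j → lookup xs (π ⟨$⟩ʳ suc j)) ≡ reorder (Perm.remove zero π) (removeAt xs i)
  tail≡ = Vecₚ.tabulate-cong λ j →
    Eq.trans (cong (lookup xs) (Perm.punchIn-permute π zero j)) (sym (lookup-removeAt xs i _))
  tail↭ : toList (tabulate (λ j → lookup xs (π ⟨$⟩ʳ suc j))) ↭ toList (removeAt xs i)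
  tail↭ = subst (λ v → toList v ↭ toList (removeAt xs i)) (sym tail≡)
                (reorder-↭ (Perm.remove zero π) (removeAt xs i))

↭⇒reorder : ∀ {n} (xs : Vec A n) ys → ys ↭ toList xs → ∃[ π ] toList (reorder π xs) ≡ ys
↭⇒reorder []       ys       p = Perm.id , sym (↭-empty-inv p)
↭⇒reorder (_ ∷ _)  []       p with () ← ↭-length p
↭⇒reorder xs@(_ ∷ _) (y ∷ ys) p
  with y∈xs ← ∈-toList⁻ (∈-resp-↭ p (here refl))
  with i ← VecAny.index y∈xs | refl ← lookup-index y∈xs
  with ρ , ρ-ok ← ↭⇒reorder (removeAt xs i) ys (drop-∷ (trans p (toList-↭-lookup∷removeAt xs i)))
  = Perm.insert zero i ρ , cong (_ ∷_) (Eq.trans (cong toList tail≡) ρ-ok)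
  where
  tail≡ : tabulate (λ j → lookup xs (Perm.insert zero i ρ ⟨$⟩ʳ suc j)) ≡ reorder ρ (removeAt xs i)
  tail≡ = Vecₚ.tabulate-cong λ j →
    Eq.trans (cong (lookup xs) (Perm.insert-punchIn zero i ρ j)) (sym (lookup-removeAt xs i _))

-- Selecting and merging along a flag vector

sel-map : ∀ {s} (f : A → B′) (I : Vec Bool s) (t : Vec A s) → sel I (Vec.map f t) ≡ List.map f (sel I t)
sel-map f []          []      = refl
sel-map f (true ∷ I)  (x ∷ t) = cong (f x ∷_) (sel-map f I t)
sel-map f (false ∷ I) (x ∷ t) = sel-map f I t

length-sel : ∀ {s} (I : Vec Bool s) (t : Vec A s) → List.length (sel I t) ≡ count I
length-sel []          []      = refl
length-sel (true ∷ I)  (_ ∷ t) = cong suc (length-sel I t)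
length-sel (false ∷ I) (_ ∷ t) = length-sel I t

count+count-compl : ∀ {s} (I : Vec Bool s) → count I + count (compl I) ≡ s
count+count-compl []          = refl
count+count-compl (true ∷ I)  = cong suc (count+count-compl I)
count+count-compl (false ∷ I) = Eq.trans (ℕ.+-suc _ _) (cong suc (count+count-compl I))

↭-++⇒sel : ∀ {s} (xs : Vec A s) ys zs → toList xs ↭ ys ++ zs →
           ∃[ I ] (sel I xs ↭ ys × sel (compl I) xs ↭ zs)
↭-++⇒sel []       []      []      _ = [] , refl , refl
↭-++⇒sel []       (_ ∷ _) _       p with () ← ↭-length p
↭-++⇒sel []       []      (_ ∷ _) p with () ← ↭-length p
↭-++⇒sel (x ∷ xs) ys      zs      p with ∈-++⁻ ys (∈-resp-↭ p (here refl))
... | inj₁ x∈ys with ys₁ , ys₂ , refl ← ∈-∃++ x∈ys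
  with I , q₁ , q₂ ← ↭-++⇒sel xs (ys₁ ++ ys₂) zs (drop-∷ (trans p (++⁺ʳ zs (shift x ys₁ ys₂))))
  = true ∷ I , trans (prep x q₁) (↭-sym (shift x ys₁ ys₂)) , q₂
... | inj₂ x∈zs with zs₁ , zs₂ , refl ← ∈-∃++ x∈zs
  with I , q₁ , q₂ ← ↭-++⇒sel xs ys (zs₁ ++ zs₂)
                       (drop-∷ (trans p (trans (++⁺ˡ ys (shift x zs₁ zs₂)) (shift x ys (zs₁ ++ zs₂)))))
  = false ∷ I , q₁ , trans (prep x q₂) (↭-sym (shift x zs₁ zs₂))

merge : ∀ {s} → Vec Bool s → List A → List A → List A
merge []          _        _        = []
merge (true ∷ I)  (a ∷ as) bs       = a ∷ merge I as bs
merge (true ∷ I)  []       _        = []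
merge (false ∷ I) as       (b ∷ bs) = b ∷ merge I as bs
merge (false ∷ I) _        []       = []

merge-sel : ∀ {s} (I : Vec Bool s) (t : Vec A s) → merge I (sel I t) (sel (compl I) t) ≡ toList t
merge-sel []          []      = refl
merge-sel (true ∷ I)  (x ∷ t) = cong (x ∷_) (merge-sel I t)
merge-sel (false ∷ I) (x ∷ t) = cong (x ∷_) (merge-sel I t)

map-merge : ∀ {s} (f : A → B′) (I : Vec Bool s) as bs →
            List.map f (merge I as bs) ≡ merge I (List.map f as) (List.map f bs)
map-merge f []          _        _        = refl
map-merge f (true ∷ I)  (a ∷ as) bs       = cong (f a ∷_) (map-merge f I as bs)
map-merge f (true ∷ I)  []       _        = refl
map-merge f (false ∷ I) as       (b ∷ bs) = cong (f b ∷_) (map-merge f I as bs)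
map-merge f (false ∷ I) _        []       = refl

merge-↭-++ : ∀ {s} (I : Vec Bool s) (as bs : List A) →
          List.length as ≡ count I → List.length bs ≡ count (compl I) → merge I as bs ↭ as ++ bs
merge-↭-++ []          []       []       _     _     = refl
merge-↭-++ (true ∷ I)  (a ∷ as) bs       |as|  |bs|  = prep a (merge-↭-++ I as bs (ℕ.suc-injective |as|) |bs|)
merge-↭-++ (false ∷ I) as       (b ∷ bs) |as|  |bs|  =
  trans (prep b (merge-↭-++ I as bs |as| (ℕ.suc-injective |bs|))) (↭-sym (shift b as bs))

-- Satisfying R through the reduced relations

toList-union : ∀ {m k k'} (h : k' ≤ k) (C₁ : Vec (BVec m) k') (C₂ : Vec (BVec m) (k ∸ k')) →
               toList (union h C₁ C₂) ≡ toList C₁ ++ toList C₂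
toList-union h C₁ C₂ = Eq.trans (Vecₚ.toList-cast _ (C₁ Vec.++ C₂)) (Vecₚ.toList-++ C₁ C₂)

sel-col : ∀ {m s r} (I : Vec Bool s) (D : Vec (BVec m) s) {E : Vec (BVec m) r} →
          toList E ≡ sel I D → ∀ j → sel I (col j D) ≡ toList (col j E)
sel-col I D {E} E≡ j = begin
  sel I (col j D)              ≡⟨ sel-map _ I D ⟩
  List.map _ (sel I D)         ≡⟨ cong (List.map _) (sym E≡) ⟩
  List.map _ (toList E)        ≡⟨ sym (Vecₚ.toList-map _ E) ⟩
  toList (col j E)             ∎
  where open ≡-Reasoning

col-merge : ∀ {m s r₁ r₂} {I : Vec Bool s} {D : Vec (BVec m) s} {t : BVec s} {C₁ : Vec (BVec m) r₁} {C₂ : Vec (BVec m) r₂} →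
            toList D ≡ merge I (toList C₁) (toList C₂) → ∀ j →
            sel I t ≡ toList (col j C₁) → sel (compl I) t ≡ toList (col j C₂) → col j D ≡ t
col-merge {I = I} {D} {t} {C₁} {C₂} D≡ j t₁≡ t₂≡ =
  Eq.trans (sym (Vecₚ.cast-is-id refl (col j D))) (Vecₚ.toList-injective refl (col j D) t (begin
  toList (col j D)                                    ≡⟨ Vecₚ.toList-map _ D ⟩
  List.map _ (toList D)                               ≡⟨ cong (List.map _) D≡ ⟩
  List.map _ (merge I (toList C₁) (toList C₂))        ≡⟨ map-merge _ I (toList C₁) (toList C₂) ⟩
  merge I (List.map _ (toList C₁)) (List.map _ (toList C₂))
    ≡⟨ cong₂ (merge I) (sym (Vecₚ.toList-map _ C₁)) (sym (Vecₚ.toList-map _ C₂)) ⟩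
  merge I (toList (col j C₁)) (toList (col j C₂))    ≡⟨ cong₂ (merge I) (sym t₁≡) (sym t₂≡) ⟩
  merge I (sel I t) (sel (compl I) t)                 ≡⟨ merge-sel I t ⟩
  toList t                                            ∎))
  where open ≡-Reasoning

Sat-union⇒reduced : ∀ {m k k'} (R : Rels m k) (h : k' ≤ k) (C₁ : Vec (BVec m) k') (C₂ : Vec (BVec m) (k ∸ k')) →
  Sat R (union h C₁ C₂) →
  ∃[ I ] ∃[ σ ] ∃[ τ ] (count I ≡ k' × SatTP (reduce {r = k ∸ k'} R I (reorder σ C₁)) (reorder τ C₂))
Sat-union⇒reduced R h C₁ C₂ (π , sat)
  with I , q₁ , q₂ ← ↭-++⇒sel (reorder π (union h C₁ C₂)) (toList C₁) (toList C₂)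
                       (trans (reorder-↭ π (union h C₁ C₂)) (↭-reflexive (toList-union h C₁ C₂)))
  with σ , σ-ok ← ↭⇒reorder C₁ _ q₁ | τ , τ-ok ← ↭⇒reorder C₂ _ q₂
  = I , σ , τ , |I|≡k' , λ j → _ , sat j , sel-col I D σ-ok j , sel-col (compl I) D τ-ok j
  where
  D = reorder π (union h C₁ C₂)
  |I|≡k' : count I ≡ _
  |I|≡k' = Eq.trans (sym (length-sel I D)) (Eq.trans (↭-length q₁) (Vecₚ.length-toList C₁))

merge-↭-union : ∀ {m k k'} (h : k' ≤ k) (C₁ : Vec (BVec m) k') (C₂ : Vec (BVec m) (k ∸ k'))
  (I : Vec Bool k) (σ : Permutation′ k') → count I ≡ k' →
  merge I (toList (reorder σ C₁)) (toList C₂) ↭ toList (union h C₁ C₂)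
merge-↭-union {k = k} h C₁ C₂ I σ |I|≡k' =
  trans (merge-↭-++ I _ _ (Eq.trans (Vecₚ.length-toList (reorder σ C₁)) (sym |I|≡k')) |C₂|≡)
        (trans (++⁺ʳ (toList C₂) (reorder-↭ σ C₁)) (↭-reflexive (sym (toList-union h C₁ C₂))))
  where
  |C₂|≡ : List.length (toList C₂) ≡ count (compl I)
  |C₂|≡ = Eq.trans (Vecₚ.length-toList C₂)
    (Eq.trans (cong (k ∸_) (sym |I|≡k'))
    (Eq.trans (cong (_∸ count I) (sym (count+count-compl I))) (ℕ.m+n∸m≡n (count I) _)))

reduced⇒Sat-union : ∀ {m k k'} (R : Rels m k) (h : k' ≤ k) (C₁ : Vec (BVec m) k') (C₂ : Vec (BVec m) (k ∸ k'))
  (I : Vec Bool k) (σ : Permutation′ k') → count I ≡ k' →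
  SatTP (reduce {r = k ∸ k'} R I (reorder σ C₁)) C₂ → Sat R (union h C₁ C₂)
reduced⇒Sat-union R h C₁ C₂ I σ |I|≡k' sat
  with π , π-ok ← ↭⇒reorder (union h C₁ C₂) _ (merge-↭-union h C₁ C₂ I σ |I|≡k')
  = π , λ j → let t , Rt , t₁≡ , t₂≡ = sat j in
              subst (T ∘ R j) (sym (col-merge π-ok j t₁≡ t₂≡)) Rt

SatTP-reduce? : ∀ {m k s r} (R : Rels m k) (I : Vec Bool k) (C₁ : Vec (BVec m) s) →
                Decidable₁ (SatTP (reduce {r = r} R I C₁))
SatTP-reduce? R I C₁ C = Fin.all? λ j → searchable-Vec searchable-Bool _ _ λ t →
  T? (R j t) ×-dec (List.≡-dec Bool._≟_ _ _ ×-dec List.≡-dec Bool._≟_ _ _)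

-- Costs

minDistL : ∀ {m} → BVec m → List (BVec m) → ℕ∞
minDistL x = List.foldr (λ y → min∞ (fin (dH x y))) ∞

minDist≡minDistL : ∀ {m s} (x : BVec m) (C : Vec (BVec m) s) → minDist x C ≡ minDistL x (toList C)
minDist≡minDistL x []      = refl
minDist≡minDistL x (_ ∷ C) = cong (min∞ _) (minDist≡minDistL x C)

minDistL-↭ : ∀ {m} (x : BVec m) {xs ys} → xs ↭ ys → minDistL x xs ≡ minDistL x ys
minDistL-↭ x refl         = refl
minDistL-↭ x (prep _ p)   = cong (min∞ _) (minDistL-↭ x p)
minDistL-↭ x (swap {xs} {ys} y z p) = begin
  min∞ dy (min∞ dz (minDistL x xs))  ≡⟨ sym (min∞-assoc dy dz (minDistL x xs)) ⟩
  min∞ (min∞ dy dz) (minDistL x xs)  ≡⟨ cong₂ min∞ (min∞-comm dy dz) (minDistL-↭ x p) ⟩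
  min∞ (min∞ dz dy) (minDistL x ys)  ≡⟨ min∞-assoc dz dy (minDistL x ys) ⟩
  min∞ dz (min∞ dy (minDistL x ys))  ∎
  where
  open ≡-Reasoning
  dy = fin (dH x y)
  dz = fin (dH x z)
minDistL-↭ x (trans p q)  = Eq.trans (minDistL-↭ x p) (minDistL-↭ x q)

minDistL-++ : ∀ {m} (x : BVec m) xs ys → minDistL x (xs ++ ys) ≡ min∞ (minDistL x xs) (minDistL x ys)
minDistL-++ x []       ys = refl
minDistL-++ x (y ∷ xs) ys =
  Eq.trans (cong (min∞ _) (minDistL-++ x xs ys)) (sym (min∞-assoc (fin (dH x y)) (minDistL x xs) (minDistL x ys)))

minDist-union : ∀ {m k k'} (h : k' ≤ k) (C₁ : Vec (BVec m) k') (C₂ : Vec (BVec m) (k ∸ k')) x →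
                minDist x (union h C₁ C₂) ≡ min∞ (minDist x C₁) (minDist x C₂)
minDist-union h C₁ C₂ x = begin
  minDist x (union h C₁ C₂)                              ≡⟨ minDist≡minDistL x (union h C₁ C₂) ⟩
  minDistL x (toList (union h C₁ C₂))                    ≡⟨ cong (minDistL x) (toList-union h C₁ C₂) ⟩
  minDistL x (toList C₁ ++ toList C₂)                    ≡⟨ minDistL-++ x (toList C₁) (toList C₂) ⟩
  min∞ (minDistL x (toList C₁)) (minDistL x (toList C₂)) ≡⟨ sym (cong₂ min∞ (minDist≡minDistL x C₁) (minDist≡minDistL x C₂)) ⟩
  min∞ (minDist x C₁) (minDist x C₂)                     ∎
  where open ≡-Reasoning

minDist-reorder : ∀ {m s} (σ : Permutation′ s) (C : Vec (BVec m) s) x → minDist x (reorder σ C) ≡ minDist x C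
minDist-reorder σ C x = begin
  minDist x (reorder σ C)            ≡⟨ minDist≡minDistL x (reorder σ C) ⟩
  minDistL x (toList (reorder σ C))  ≡⟨ minDistL-↭ x (reorder-↭ σ C) ⟩
  minDistL x (toList C)              ≡⟨ sym (minDist≡minDistL x C) ⟩
  minDist x C                        ∎
  where open ≡-Reasoning

cost-cong : ∀ {m n s s'} (X : Vec (BVec m) n) (A : Vec Bool n) {C : Vec (BVec m) s} {C' : Vec (BVec m) s'} →
            (∀ x → minDist x C ≡ minDist x C') → cost X A C ≡ cost X A C'
cost-cong []      []          _ = refl
cost-cong (x ∷ X) (true ∷ A)  e = cong₂ _⊕_ (e x) (cost-cong X A e)
cost-cong (x ∷ X) (false ∷ A) e = cost-cong X A e

cost-reorder : ∀ {m n s} (X : Vec (BVec m) n) (A : Vec Bool n) (σ : Permutation′ s) (C : Vec (BVec m) s) →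
               cost X A (reorder σ C) ≡ cost X A C
cost-reorder X A σ C = cost-cong X A (minDist-reorder σ C)

module _ {m k k'} (h : k' ≤ k) (C₁ : Vec (BVec m) k') where

  closerTo : ∀ {n} → Vec (BVec m) (k ∸ k') → Vec (BVec m) n → Vec Bool n
  closerTo C₂ = Vec.map λ x → does (minDist x C₂ <∞? minDist x C₁)

  cost-union-split : ∀ {n} (C₂ : Vec (BVec m) (k ∸ k')) (X : Vec (BVec m) n) (A : Vec Bool n) →
    cost X A (union h C₁ C₂) ≡ cost X (A ∧f compl (closerTo C₂ X)) C₁ ⊕ cost X (A ∧f closerTo C₂ X) C₂
  cost-union-split C₂ []      []          = refl
  cost-union-split C₂ (x ∷ X) (false ∷ A) = cost-union-split C₂ X A
  cost-union-split C₂ (x ∷ X) (true ∷ A) with minDist x C₂ <∞? minDist x C₁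
  ... | yes closer = Eq.trans
    (cong₂ _⊕_ (Eq.trans (minDist-union h C₁ C₂ x) (min∞-selectʳ d₁ d₂ closer)) (cost-union-split C₂ X A))
    (x⊕[y⊕z]≡y⊕[x⊕z] d₂ (cost X A₁ C₁) (cost X A₂ C₂))
    where d₁ = minDist x C₁; d₂ = minDist x C₂; A₁ = A ∧f compl (closerTo C₂ X); A₂ = A ∧f closerTo C₂ X
  ... | no ¬closer = Eq.trans
    (cong₂ _⊕_ (Eq.trans (minDist-union h C₁ C₂ x) (min∞-selectˡ d₁ d₂ ¬closer)) (cost-union-split C₂ X A))
    (sym (⊕-assoc d₁ (cost X A₁ C₁) (cost X A₂ C₂)))
    where d₁ = minDist x C₁; d₂ = minDist x C₂; A₁ = A ∧f compl (closerTo C₂ X); A₂ = A ∧f closerTo C₂ X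

  cost-union-≤ : ∀ {n} (D : Vec (BVec m) (k ∸ k')) (X : Vec (BVec m) n) (A Z : Vec Bool n) →
    cost X A (union h C₁ D) ≤∞ (cost X (A ∧f compl Z) C₁ ⊕ cost X (A ∧f Z) D)
  cost-union-≤ D []      []          []          = ℕ.≤-refl
  cost-union-≤ D (x ∷ X) (false ∷ A) (_ ∷ Z)     = cost-union-≤ D X A Z
  cost-union-≤ D (x ∷ X) (true ∷ A)  (true ∷ Z)  = ≤∞-trans
    (⊕-mono-≤∞ (≤∞-trans (≤∞-reflexive (minDist-union h C₁ D x)) (min∞-≤ʳ (minDist x C₁) (minDist x D)))
               (cost-union-≤ D X A Z))
    (≤∞-reflexive (x⊕[y⊕z]≡y⊕[x⊕z] (minDist x D) (cost X (A ∧f compl Z) C₁) (cost X (A ∧f Z) D)))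
  cost-union-≤ D (x ∷ X) (true ∷ A)  (false ∷ Z) = ≤∞-trans
    (⊕-mono-≤∞ (≤∞-trans (≤∞-reflexive (minDist-union h C₁ D x)) (min∞-≤ˡ (minDist x C₁) (minDist x D)))
               (cost-union-≤ D X A Z))
    (≤∞-reflexive (sym (⊕-assoc (minDist x C₁) (cost X (A ∧f compl Z) C₁) (cost X (A ∧f Z) D))))

cost-union-reorder : ∀ {m n k k'} (X : Vec (BVec m) n) (A : Vec Bool n) (h : k' ≤ k) (C₁ : Vec (BVec m) k')
  (τ : Permutation′ (k ∸ k')) (C₂ : Vec (BVec m) (k ∸ k')) →
  cost X A (union h C₁ (reorder τ C₂)) ≡ cost X A (union h C₁ C₂)
cost-union-reorder X A h C₁ τ C₂ = cost-cong X A λ x → begin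
  minDist x (union h C₁ (reorder τ C₂))           ≡⟨ minDist-union h C₁ (reorder τ C₂) x ⟩
  min∞ (minDist x C₁) (minDist x (reorder τ C₂))  ≡⟨ cong (min∞ (minDist x C₁)) (minDist-reorder τ C₂ x) ⟩
  min∞ (minDist x C₁) (minDist x C₂)              ≡⟨ sym (minDist-union h C₁ C₂ x) ⟩
  minDist x (union h C₁ C₂)                       ∎
  where open ≡-Reasoning

+n/1≡mkℚ : ∀ n → (+ n / 1) ≡ mkℚ (+ n) 0 (Coprimality.sym (Coprimality.1-coprimeTo n))
+n/1≡mkℚ n = ℚ.normalize-coprime (Coprimality.sym (Coprimality.1-coprimeTo n))

ℕ→ℚ-mono-≤ : ∀ {a b} → a ≤ b → (+ a / 1) ≤ℚ (+ b / 1)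
ℕ→ℚ-mono-≤ {a} {b} a≤b rewrite +n/1≡mkℚ a | +n/1≡mkℚ b =
  ℚ.*≤* (subst₂ ℤ._≤_ (sym (ℤ.*-identityʳ (+ a))) (sym (ℤ.*-identityʳ (+ b))) (ℤ.+≤+ a≤b))

LeScaled-mono : ∀ {a b} δ o → a ≤∞ b → LeScaled b δ o → LeScaled a δ o
LeScaled-mono             δ ∞       _   _  = tt
LeScaled-mono {fin _} {fin _} δ (fin _) a≤b b≤ = ℚ.≤-trans (ℕ→ℚ-mono-≤ a≤b) b≤
LeScaled-mono {fin _} {∞}     δ (fin _) _   ()
LeScaled-mono {∞}     {∞}     δ (fin _) _   ()

-- Optimal completions of the reduced instance

reduced⇒SatProj : ∀ {m k s r} {R : Rels m k} {I : Vec Bool k} {C₁ : Vec (BVec m) s} {C : Vec (BVec m) r} →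
                  SatTP (reduce R I C₁) C → SatProj R I C₁
reduced⇒SatProj sat j = let t , Rt , t₁≡ , _ = sat j in t , Rt , t₁≡

minimum⇒IsOptimalP : ∀ {m n r} (X : Vec (BVec m) n) (Z : Vec Bool n) (R′ : PRels m r) {C : Vec (BVec m) r} →
                     IsMinimumOf (cost X Z) (SatTP R′) C → IsOptimalP X Z R′ C
minimum⇒IsOptimalP X Z R′ {C} (sat , minimal) =
  (Perm.id , subst (SatTP R′) (sym (Vecₚ.tabulate∘lookup C)) sat) ,
  λ { C′ (ρ , sat′) → ≤∞-trans (minimal _ sat′) (≤∞-reflexive (cost-reorder X Z ρ C′)) }

module _ {m n k k'} (X : Vec (BVec m) n) (R : Rels m k) (B : Vec Bool n) (h : k' ≤ k)
         (C₁ : Vec (BVec m) k') (I : Vec Bool k) (σ : Permutation′ k') where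

  private
    R′ : PRels m (k ∸ k')
    R′ = reduce R I (reorder σ C₁)

    V : Vec (BVec m) (k ∸ k') → ℕ∞
    V C = cost X (compl B) (union h C₁ C)

    search : Searchable (Vec (BVec m) (k ∸ k'))
    search = searchable-Vec (searchable-Vec searchable-Bool m) (k ∸ k')

  optimal-completion : ∀ C₀ → SatTP R′ C₀ →
    ∃[ C ] (SatTP R′ C × V C ≤∞ V C₀ × ∃[ Z ]
      (V C ≡ cost X (compl B ∧f compl Z) C₁ ⊕ cost X (compl B ∧f Z) C × IsOptimalP X (compl B ∧f Z) R′ C))
  optimal-completion C₀ sat₀
    with C₂ , sat₂ , V-minimal ← argmin search (SatTP-reduce? R I (reorder σ C₁)) V (C₀ , sat₀)
    with C , sat , Z-minimal ← argmin search (SatTP-reduce? R I (reorder σ C₁))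
                                 (cost X (compl B ∧f closerTo h C₁ C₂ X)) (C₂ , sat₂)
    = C , sat , ≤∞-trans V-C≤V-C₂ (V-minimal C₀ sat₀) , Z ,
      ≤∞-antisym V-C≤split (≤∞-trans split≤V-C₂ (V-minimal C sat)) ,
      minimum⇒IsOptimalP X (compl B ∧f Z) R′ (sat , Z-minimal)
    where
    Z = closerTo h C₁ C₂ X
    cost₁ = cost X (compl B ∧f compl Z) C₁
    V-C≤split : V C ≤∞ (cost₁ ⊕ cost X (compl B ∧f Z) C)
    V-C≤split = cost-union-≤ h C₁ C X (compl B) Z
    split≤V-C₂ : (cost₁ ⊕ cost X (compl B ∧f Z) C) ≤∞ V C₂
    split≤V-C₂ = ≤∞-trans (⊕-mono-≤∞ (≤∞-refl {cost₁}) (Z-minimal C₂ sat₂))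
                          (≤∞-reflexive (sym (cost-union-split h C₁ C₂ X (compl B))))
    V-C≤V-C₂ : V C ≤∞ V C₂
    V-C≤V-C₂ = ≤∞-trans V-C≤split split≤V-C₂

-- The hypothesis 0 ≤ δ is unused: the good extension never costs more than the given one.
lemma8 : ∀ {m n k k' : ℕ} (X : Vec (BVec m) n) (R : Rels m k) (δ : ℚ) → 0ℚ ≤ℚ δ →
    (B : Vec Bool n) (C1 : Vec (BVec m) k') (h : k' ≤ k) →
    Extendable X R δ h C1 B →
    ∃[ C2 ] IsGood X R δ h C1 B C2
lemma8 {n = n} X R δ _ B C₁ h (C₀ , sat₀ , bound)
  with I , σ , τ , |I|≡k' , red₀ ← Sat-union⇒reduced R h C₁ C₀ sat₀
  with C , red , V≤ , Z , V≡ , optimal ← optimal-completion X R B h C₁ I σ (reorder τ C₀) red₀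
  = C , (reduced⇒Sat-union R h C₁ C I σ |I|≡k' red , within-bound) ,
    Z , I , V≡ , |I|≡k' , σ , reduced⇒SatProj {R = R} {I = I} red , optimal
  where
  within-bound : ∀ o → IsOPT X (allFlags n) R o →
                 LeScaled (cost X B C₁ ⊕ cost X (compl B) (union h C₁ C)) δ o
  within-bound o isOPT = LeScaled-mono δ o
    (⊕-mono-≤∞ (≤∞-refl {cost X B C₁}) (≤∞-trans V≤ (≤∞-reflexive (cost-union-reorder X (compl B) h C₁ τ C₀))))
    (bound o isOPT)
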